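{- Let $S=\{\sigma,\mu\}$ with $\mu(0)=01$, $\mu(1)=10$, $\sigma(0)=00$, $\sigma(1)=11$. Let $(s_k)_{k\ge1}$ be a sequence of positive integers each of which is a power of two (i.e. $s_k\in\{2^n:n\ge0\}$ for all $k$). Then there exists an $S$-adic sequence $\mathbf{w}$ such that $\mathcal{L}^{\mathbf{w}}=\mathcal{L}^{(s_k)}$.
   Context: A factor of a word is a contiguous subword. For a binary sequence $\mathbf{w}\in\{0,1\}^{\mathbb{N}}$, $\mathcal{L}^{\mathbf{w}}$ is the set of all finite factors of $\mathbf{w}$ (including the empty word). Given a set $S$ of morphisms of $\{0,1\}^*$, a binary sequence $\mathbf{w}$ is $S$-adic if there exist $(\sigma_n)_{n\ge1}$ with $\sigma_n\in S$ and letters $(a_n)_{n\ge1}$ in $\{0,1\}$ such that $\mathbf{w}=\lim_{n\to\infty}\sigma_1\cdots\sigma_n(a_na_na_n\cdots)$. For a binary word $\gamma_1\cdots\gamma_n$ the complement is $(1-\gamma_1)\cdots(1-\gamma_n)$. For a sequence $(s_k)$ of positive integers set $\alpha^{(s_k)}_1=01$ and $\alpha^{(s_k)}_{i+1}=(\alpha^{(s_k)}_i)^{s_i}(\overline{\alpha}^{(s_k)}_i)^{s_i}$; $\mathcal{L}^{(s_k)}$ is the set of all factors (including the empty word) of the words $\alpha^{(s_k)}_i$, $i\ge1$. -}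

module Defs where

open import Data.Bool using (Bool; true; false; not)
open import Data.Nat using (ℕ; zero; suc; _≤_; _<_; _^_; _/_; _%_)
open import Data.List using (List; []; _∷_; _++_; map; concat; replicate)
open import Data.Product using (Σ; ∃; ∃-syntax; _×_; _,_)
open import Relation.Binary.PropositionalEquality using (_≡_)

-- Letters: 0 = false, 1 = true.
Word : Set
Word = List Bool

Seq : Set
Seq = ℕ → Bool

data Morph : Set where
  σ μ : Morph

img : Morph → Bool → Bool × Bool
img σ b = b , b
img μ false = false , true
img μ true = true , false

-- Morphism applied to an infinite sequence (both morphisms are 2-uniform:
-- the letter at position i of φ(x) is letter (i mod 2) of φ(x (i / 2))).
pick : Bool × Bool → ℕ → Bool
pick (x , y) zero = x
pick (x , y) (suc _) = y

applyS : Morph → Seq → Seq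
applyS m x i = pick (img m (x (i / 2))) (i % 2)

-- comp ms n x = ms 0 ∘ ms 1 ∘ ⋯ ∘ ms (n-1) applied to x
-- (ms k plays the role of σ_{k+1} in the paper).
comp : (ℕ → Morph) → ℕ → Seq → Seq
comp ms zero x = x
comp ms (suc n) x = comp ms n (applyS (ms n) x)

constSeq : Bool → Seq
constSeq a _ = a

-- w = lim_{n→∞} σ_1⋯σ_n(a_n a_n a_n ⋯) in the product topology:
-- every prefix of w eventually agrees.  (a m plays the role of a_{m+1}.)
IsLimit : (ℕ → Morph) → (ℕ → Bool) → Seq → Set
IsLimit ms a w =
  ∀ (N : ℕ) → ∃[ M ] ∀ (m : ℕ) → M ≤ m → ∀ (i : ℕ) → i < N →
    comp ms (suc m) (constSeq (a m)) i ≡ w i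

SAdic : Seq → Set
SAdic w = ∃[ ms ] ∃[ a ] IsLimit ms a w

window : Seq → ℕ → ℕ → Word
window w i zero = []
window w i (suc n) = w i ∷ window w (suc i) n

InLangSeq : Seq → Word → Set
InLangSeq w u = ∃[ i ] window w i (Data.List.length u) ≡ u

FactorOf : Word → Word → Set
FactorOf u v = ∃[ p ] ∃[ q ] p ++ u ++ q ≡ v

complement : Word → Word
complement = map not

power : ℕ → Word → Word
power k u = concat (replicate k u)

-- alpha s i = α^{(s_k)}_{i+1}, with s k playing the role of s_{k+1}.
alpha : (ℕ → ℕ) → ℕ → Word
alpha s zero = false ∷ true ∷ []
alpha s (suc i) = power (s i) (alpha s i) ++ power (s i) (complement (alpha s i))

InLangS : (ℕ → ℕ) → Word → Set
InLangS s u = ∃[ i ] FactorOf u (alpha s i)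

{-# OPTIONS --safe #-}
-- Write s k = 2 ^ e k.  Along the directive sequence μ σ^(e 0) μ σ^(e 1) μ ⋯ the
-- composition of the first depth e k morphisms maps 0 to alpha s k and 1 to its
-- complement; the next block σ^(e k) μ maps 0 to 0^(s k) 1^(s k), which those
-- morphisms then turn into alpha s (k + 1).  Since σ and μ map every letter a to a
-- word beginning with a, the images of a constant sequence stabilise to a limit w
-- having every alpha s k as a prefix, and a sequence with prefixes of unbounded
-- length has exactly the factors of those prefixes as its factors.
module Submission where

open import Defs
open import Data.Nat using (ℕ; _^_)
open import Data.Product using (Σ; ∃; ∃-syntax; _×_; _,_)
open import Relation.Binary.PropositionalEquality using (_≡_)

open import Data.Bool using (Bool; true; false)
open import Data.Nat using (zero; suc; _+_; _*_; _∸_; _≤_; _<_; _≤′_; ≤′-refl; ≤′-step; z≤n; s≤s; _/_; _%_; NonZero)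
open import Data.Nat.Properties
open import Data.Nat.DivMod using (m/n≡1+[m∸n]/n; m/n/o≡m/[n*o]; /-congʳ; n/1≡n; m<n⇒m/n≡0)
open import Data.List using ([]; _∷_; _++_; length)
open import Data.List.Properties using (++-assoc; ∷-injectiveˡ; ∷-injectiveʳ)
open import Data.Product using (proj₁; proj₂)
open import Data.Sum using (inj₁; inj₂)
open import Relation.Binary.PropositionalEquality
  using (refl; sym; trans; cong; cong₂; subst; module ≡-Reasoning)
open ≡-Reasoning

_/2^_ : ℕ → ℕ → ℕ
i /2^ n = _/_ i (2 ^ n) {{m^n≢0 2 n}}

n<2^n : ∀ n → n < 2 ^ n
n<2^n zero = s≤s z≤n
n<2^n (suc n) = +-mono-≤ {1} (m^n>0 2 n) (≤-trans (n<2^n n) (m≤m+n (2 ^ n) 0))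

double : ℕ → ℕ
double zero = zero
double (suc n) = suc (suc (double n))

double≡2* : ∀ n → double n ≡ 2 * n
double≡2* zero = refl
double≡2* (suc n) = cong suc (trans (cong suc (double≡2* n)) (sym (+-suc n (n + 0))))

2+n/2≡1+n/2 : ∀ n → suc (suc n) / 2 ≡ suc (n / 2)
2+n/2≡1+n/2 n = m/n≡1+[m∸n]/n {suc (suc n)} {2} (s≤s (s≤s z≤n))

double/2 : ∀ n → double n / 2 ≡ n
double/2 zero = refl
double/2 (suc n) = trans (2+n/2≡1+n/2 (double n)) (cong suc (double/2 n))

1+double/2 : ∀ n → suc (double n) / 2 ≡ n
1+double/2 zero = refl
1+double/2 (suc n) = trans (2+n/2≡1+n/2 (suc (double n))) (cong suc (1+double/2 n))

double%2 : ∀ n → double n % 2 ≡ 0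
double%2 zero = refl
double%2 (suc n) = double%2 n

1+double%2 : ∀ n → suc (double n) % 2 ≡ 1
1+double%2 zero = refl
1+double%2 (suc n) = 1+double%2 n

/2^n/2 : ∀ i n → i /2^ n / 2 ≡ i /2^ suc n
/2^n/2 i n = trans (m/n/o≡m/[n*o] i (2 ^ n) 2 {{m^n≢0 2 n}} {{_}} {{2^n*2-nonZero}})
                   (/-congʳ {{2^n*2-nonZero}} {{m^n≢0 2 (suc n)}} (*-comm (2 ^ n) 2))
  where
    2^n*2-nonZero : NonZero (2 ^ n * 2)
    2^n*2-nonZero = subst NonZero (*-comm 2 (2 ^ n)) (m^n≢0 2 (suc n))

power-+ : ∀ m n (u : Word) → power (m + n) u ≡ power m u ++ power n u
power-+ zero n u = refl
power-+ (suc m) n u = trans (cong (u ++_) (power-+ m n u)) (sym (++-assoc u (power m u) (power n u)))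

module _ {w : Seq} where

  window-length : ∀ i n → length (window w i n) ≡ n
  window-length i zero = refl
  window-length i (suc n) = cong suc (window-length (suc i) n)

  window-+ : ∀ i m n → window w i (m + n) ≡ window w i m ++ window w (i + m) n
  window-+ i zero n = cong (λ j → window w j n) (sym (+-identityʳ i))
  window-+ i (suc m) n = cong (w i ∷_) (trans (window-+ (suc i) m n)
    (cong (λ j → window w (suc i) m ++ window w j n) (sym (+-suc i m))))

  window-prefix : ∀ i n u v → window w i n ≡ u ++ v → window w i (length u) ≡ u
  window-prefix i n [] v eq = refl
  window-prefix i zero (b ∷ u) v ()
  window-prefix i (suc n) (b ∷ u) v eq =
    cong₂ _∷_ (∷-injectiveˡ eq) (window-prefix (suc i) n u v (∷-injectiveʳ eq))

  window-suffix : ∀ i n u v → window w i n ≡ u ++ v → window w (i + length u) (length v) ≡ v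
  window-suffix i n [] v eq =
    trans (cong₂ (window w) (+-identityʳ i) (trans (sym (cong length eq)) (window-length i n))) eq
  window-suffix i zero (b ∷ u) v ()
  window-suffix i (suc n) (b ∷ u) v eq =
    trans (cong (λ j → window w j (length v)) (+-suc i (length u)))
          (window-suffix (suc i) n u v (∷-injectiveʳ eq))

window-cong : ∀ {w w′ : Seq} i n → (∀ j → j < i + n → w j ≡ w′ j) → window w i n ≡ window w′ i n
window-cong i zero eq = refl
window-cong i (suc n) eq =
  cong₂ _∷_ (eq i (subst (i <_) (sym (+-suc i n)) (s≤s (m≤m+n i n))))
            (window-cong (suc i) n (λ j j<i+n → eq j (subst (j <_) (sym (+-suc i n)) j<i+n)))

language-of-prefixes : (w : Seq) (A : ℕ → Word) → (∀ k → ∃[ n ] k ≤ n × window w 0 n ≡ A k) →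
  ∀ u → (InLangSeq w u → ∃[ k ] FactorOf u (A k)) × (∃[ k ] FactorOf u (A k) → InLangSeq w u)
language-of-prefixes w A prefix u = factor⇒ , factor⇐
  where
    factor⇒ : InLangSeq w u → ∃[ k ] FactorOf u (A k)
    factor⇒ (i , eq) with prefix (i + length u)
    ... | n , i+|u|≤n , prefix-eq = i + length u , window w 0 i , window w (i + length u) r , split
      where
        r = n ∸ (i + length u)
        split : window w 0 i ++ u ++ window w (i + length u) r ≡ A (i + length u)
        split = begin
          window w 0 i ++ u ++ window w (i + length u) r
            ≡⟨ cong (λ v → window w 0 i ++ v ++ window w (i + length u) r) (sym eq) ⟩
          window w 0 i ++ window w i (length u) ++ window w (i + length u) r
            ≡⟨ cong (window w 0 i ++_) (sym (window-+ i (length u) r)) ⟩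
          window w 0 i ++ window w i (length u + r)
            ≡⟨ sym (window-+ 0 i (length u + r)) ⟩
          window w 0 (i + (length u + r))
            ≡⟨ cong (window w 0) (trans (sym (+-assoc i (length u) r)) (m+[n∸m]≡n i+|u|≤n)) ⟩
          window w 0 n
            ≡⟨ prefix-eq ⟩
          A (i + length u) ∎

    factor⇐ : ∃[ k ] FactorOf u (A k) → InLangSeq w u
    factor⇐ (k , p , q , eq) with prefix k
    ... | n , _ , prefix-eq = length p ,
      window-prefix (length p) (length (u ++ q)) u q
        (window-suffix 0 n p (u ++ q) (trans prefix-eq (sym eq)))

applyW : Morph → Word → Word
applyW m [] = []
applyW m (b ∷ u) = pick (img m b) 0 ∷ pick (img m b) 1 ∷ applyW m u

compW : (ℕ → Morph) → ℕ → Word → Word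
compW f zero u = u
compW f (suc n) u = compW f n (applyW (f n) u)

applyW-++ : ∀ m u v → applyW m (u ++ v) ≡ applyW m u ++ applyW m v
applyW-++ m [] v = refl
applyW-++ m (b ∷ u) v = cong (λ t → pick (img m b) 0 ∷ pick (img m b) 1 ∷ t) (applyW-++ m u v)

compW-++ : ∀ f n u v → compW f n (u ++ v) ≡ compW f n u ++ compW f n v
compW-++ f zero u v = refl
compW-++ f (suc n) u v =
  trans (cong (compW f n) (applyW-++ (f n) u v)) (compW-++ f n (applyW (f n) u) (applyW (f n) v))

applyW-complement : ∀ m u → applyW m (complement u) ≡ complement (applyW m u)
applyW-complement m [] = refl
applyW-complement σ (false ∷ u) = cong (λ t → true ∷ true ∷ t) (applyW-complement σ u)
applyW-complement σ (true ∷ u) = cong (λ t → false ∷ false ∷ t) (applyW-complement σ u)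
applyW-complement μ (false ∷ u) = cong (λ t → true ∷ false ∷ t) (applyW-complement μ u)
applyW-complement μ (true ∷ u) = cong (λ t → false ∷ true ∷ t) (applyW-complement μ u)

compW-complement : ∀ f n u → compW f n (complement u) ≡ complement (compW f n u)
compW-complement f zero u = refl
compW-complement f (suc n) u =
  trans (cong (compW f n) (applyW-complement (f n) u)) (compW-complement f n (applyW (f n) u))

compW-[] : ∀ f n → compW f n [] ≡ []
compW-[] f zero = refl
compW-[] f (suc n) = compW-[] f n

compW-power : ∀ f n c u → compW f n (power c u) ≡ power c (compW f n u)
compW-power f n zero u = compW-[] f n
compW-power f n (suc c) u =
  trans (compW-++ f n u (power c u)) (cong (compW f n u ++_) (compW-power f n c u))

compW-+ : ∀ f m n u → compW f (m + n) u ≡ compW f m (compW (λ j → f (m + j)) n u)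
compW-+ f m zero u = cong (λ t → compW f t u) (+-identityʳ m)
compW-+ f m (suc n) u =
  trans (cong (λ t → compW f t u) (+-suc m n)) (compW-+ f m n (applyW (f (m + n)) u))

compW-σ : ∀ f n b → (∀ j → j < n → f j ≡ σ) → compW f n (b ∷ []) ≡ power (2 ^ n) (b ∷ [])
compW-σ f zero b all-σ = refl
compW-σ f (suc n) b all-σ = begin
  compW f n (applyW (f n) (b ∷ []))
    ≡⟨ cong (λ m → compW f n (applyW m (b ∷ []))) (all-σ n (n<1+n n)) ⟩
  compW f n ((b ∷ []) ++ (b ∷ []))
    ≡⟨ compW-++ f n (b ∷ []) (b ∷ []) ⟩
  compW f n (b ∷ []) ++ compW f n (b ∷ [])
    ≡⟨ cong₂ _++_ ih ih ⟩
  power (2 ^ n) (b ∷ []) ++ power (2 ^ n) (b ∷ [])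
    ≡⟨ sym (power-+ (2 ^ n) (2 ^ n) (b ∷ [])) ⟩
  power (2 ^ n + 2 ^ n) (b ∷ [])
    ≡⟨ cong (λ t → power (2 ^ n + t) (b ∷ [])) (sym (+-identityʳ (2 ^ n))) ⟩
  power (2 ^ suc n) (b ∷ []) ∎
  where
    ih : compW f n (b ∷ []) ≡ power (2 ^ n) (b ∷ [])
    ih = compW-σ f n b (λ j j<n → all-σ j (m<n⇒m<1+n j<n))

compW-σ^n-μ : ∀ f n → (∀ j → j < n → f j ≡ σ) → f n ≡ μ →
  compW f (suc n) (false ∷ []) ≡ power (2 ^ n) (false ∷ []) ++ power (2 ^ n) (true ∷ [])
compW-σ^n-μ f n all-σ fn≡μ = begin
  compW f n (applyW (f n) (false ∷ []))
    ≡⟨ cong (λ m → compW f n (applyW m (false ∷ []))) fn≡μ ⟩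
  compW f n ((false ∷ []) ++ (true ∷ []))
    ≡⟨ compW-++ f n (false ∷ []) (true ∷ []) ⟩
  compW f n (false ∷ []) ++ compW f n (true ∷ [])
    ≡⟨ cong₂ _++_ (compW-σ f n false all-σ) (compW-σ f n true all-σ) ⟩
  power (2 ^ n) (false ∷ []) ++ power (2 ^ n) (true ∷ []) ∎

window-applyS : ∀ m x i n → window (applyS m x) (double i) (double n) ≡ applyW m (window x i n)
window-applyS m x i zero = refl
window-applyS m x i (suc n) = cong₂ _∷_ first (cong₂ _∷_ second (window-applyS m x (suc i) n))
  where
    first : applyS m x (double i) ≡ pick (img m (x i)) 0
    first = cong₂ (λ j r → pick (img m (x j)) r) (double/2 i) (double%2 i)
    second : applyS m x (suc (double i)) ≡ pick (img m (x i)) 1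
    second = cong₂ (λ j r → pick (img m (x j)) r) (1+double/2 i) (1+double%2 i)

window-comp : ∀ f n x l → window (comp f n x) 0 (2 ^ n * l) ≡ compW f n (window x 0 l)
window-comp f zero x l = cong (window x 0) (+-identityʳ l)
window-comp f (suc n) x l = begin
  window (comp f n (applyS (f n) x)) 0 (2 ^ suc n * l)
    ≡⟨ cong (window (comp f n (applyS (f n) x)) 0) 2^[1+n]*l≡2^n*double-l ⟩
  window (comp f n (applyS (f n) x)) 0 (2 ^ n * double l)
    ≡⟨ window-comp f n (applyS (f n) x) (double l) ⟩
  compW f n (window (applyS (f n) x) 0 (double l))
    ≡⟨ cong (compW f n) (window-applyS (f n) x 0 l) ⟩
  compW f (suc n) (window x 0 l) ∎
  where
    2^[1+n]*l≡2^n*double-l : 2 ^ suc n * l ≡ 2 ^ n * double l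
    2^[1+n]*l≡2^n*double-l = begin
      2 * 2 ^ n * l   ≡⟨ cong (_* l) (*-comm 2 (2 ^ n)) ⟩
      2 ^ n * 2 * l   ≡⟨ *-assoc (2 ^ n) 2 l ⟩
      2 ^ n * (2 * l) ≡⟨ cong (2 ^ n *_) (sym (double≡2* l)) ⟩
      2 ^ n * double l ∎

comp-local : ∀ f n x y i → x (i /2^ n) ≡ y (i /2^ n) → comp f n x i ≡ comp f n y i
comp-local f zero x y i eq = subst (λ j → x j ≡ y j) (n/1≡n i) eq
comp-local f (suc n) x y i eq = comp-local f n (applyS (f n) x) (applyS (f n) y) i
  (cong (λ b → pick (img (f n) b) (i /2^ n % 2)) (subst (λ j → x j ≡ y j) (sym (/2^n/2 i n)) eq))

pick-img-0 : ∀ m a → pick (img m a) 0 ≡ a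
pick-img-0 σ a = refl
pick-img-0 μ false = refl
pick-img-0 μ true = refl

comp-suc-stable : ∀ f a i m → i < 2 ^ m → comp f (suc m) (constSeq a) i ≡ comp f m (constSeq a) i
comp-suc-stable f a i m i<2^m = comp-local f m (applyS (f m) (constSeq a)) (constSeq a) i
  (trans (cong (λ j → pick (img (f m) a) (j % 2)) (m<n⇒m/n≡0 {{m^n≢0 2 m}} i<2^m)) (pick-img-0 (f m) a))

comp-stable : ∀ f a i {m m′} → i < 2 ^ m → m ≤′ m′ → comp f m′ (constSeq a) i ≡ comp f m (constSeq a) i
comp-stable f a i i<2^m ≤′-refl = refl
comp-stable f a i {m} {suc m′} i<2^m (≤′-step m≤′m′) =
  trans (comp-suc-stable f a i m′ (<-≤-trans i<2^m (^-monoʳ-≤ 2 (≤′⇒≤ m≤′m′))))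
        (comp-stable f a i i<2^m m≤′m′)

limit : (ℕ → Morph) → Bool → Seq
limit f a i = comp f i (constSeq a) i

limit-comp : ∀ f a i m → i < 2 ^ m → limit f a i ≡ comp f m (constSeq a) i
limit-comp f a i m i<2^m with ≤-total i m
... | inj₁ i≤m = sym (comp-stable f a i (n<2^n i) (≤⇒≤′ i≤m))
... | inj₂ m≤i = comp-stable f a i i<2^m (≤⇒≤′ m≤i)

limit-SAdic : ∀ f a → SAdic (limit f a)
limit-SAdic f a = f , (λ _ → a) , λ N → N , λ m N≤m i i<N →
  sym (limit-comp f a i (suc m) (<-trans (<-≤-trans i<N (≤-trans N≤m (n≤1+n m))) (n<2^n (suc m))))

limit-prefix : ∀ f a n → window (limit f a) 0 (2 ^ n) ≡ compW f n (a ∷ [])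
limit-prefix f a n = begin
  window (limit f a) 0 (2 ^ n)
    ≡⟨ window-cong 0 (2 ^ n) (λ j j<2^n → limit-comp f a j n j<2^n) ⟩
  window (comp f n (constSeq a)) 0 (2 ^ n)
    ≡⟨ cong (window (comp f n (constSeq a)) 0) (sym (*-identityʳ (2 ^ n))) ⟩
  window (comp f n (constSeq a)) 0 (2 ^ n * 1)
    ≡⟨ window-comp f n (constSeq a) 1 ⟩
  compW f n (a ∷ []) ∎

-- schedule e k r lists σ^r μ σ^(e (k + 1)) μ σ^(e (k + 2)) μ ⋯
schedule : (ℕ → ℕ) → ℕ → ℕ → ℕ → Morph
schedule e k (suc r) zero = σ
schedule e k (suc r) (suc p) = schedule e k r p
schedule e k zero zero = μ
schedule e k zero (suc p) = schedule e (suc k) (e (suc k)) p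

directives : (ℕ → ℕ) → ℕ → Morph
directives e zero = μ
directives e (suc p) = schedule e 0 (e 0) p

depth : (ℕ → ℕ) → ℕ → ℕ
depth e zero = 1
depth e (suc k) = depth e k + suc (e k)

schedule-σ : ∀ e k r j → j < r → schedule e k r j ≡ σ
schedule-σ e k (suc r) zero j<r = refl
schedule-σ e k (suc r) (suc j) (s≤s j<r) = schedule-σ e k r j j<r

schedule-μ : ∀ e k r → schedule e k r r ≡ μ
schedule-μ e k zero = refl
schedule-μ e k (suc r) = schedule-μ e k r

schedule-next : ∀ e k r p → schedule e k r (suc (r + p)) ≡ schedule e (suc k) (e (suc k)) p
schedule-next e k zero p = refl
schedule-next e k (suc r) p = schedule-next e k r p

directives-depth : ∀ e k p → directives e (depth e k + p) ≡ schedule e k (e k) p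
directives-depth e zero p = refl
directives-depth e (suc k) p = begin
  directives e (depth e k + suc (e k) + p)
    ≡⟨ cong (directives e) (+-assoc (depth e k) (suc (e k)) p) ⟩
  directives e (depth e k + suc (e k + p))
    ≡⟨ directives-depth e k (suc (e k + p)) ⟩
  schedule e k (e k) (suc (e k + p))
    ≡⟨ schedule-next e k (e k) p ⟩
  schedule e (suc k) (e (suc k)) p ∎

k≤depth : ∀ e k → k ≤ depth e k
k≤depth e zero = z≤n
k≤depth e (suc k) = subst (_≤ depth e k + suc (e k)) (+-comm k 1) (+-mono-≤ (k≤depth e k) (s≤s z≤n))

compW-directives : ∀ s e → (∀ k → s k ≡ 2 ^ e k) →
  ∀ k → compW (directives e) (depth e k) (false ∷ []) ≡ alpha s k
compW-directives s e s≡2^e zero = refl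
compW-directives s e s≡2^e (suc k) = begin
  compW f (depth e k + suc (e k)) (false ∷ [])
    ≡⟨ compW-+ f (depth e k) (suc (e k)) (false ∷ []) ⟩
  compW f (depth e k) (compW block (suc (e k)) (false ∷ []))
    ≡⟨ cong (compW f (depth e k)) (compW-σ^n-μ block (e k) block-σ block-μ) ⟩
  compW f (depth e k) (power c (false ∷ []) ++ power c (true ∷ []))
    ≡⟨ compW-++ f (depth e k) (power c (false ∷ [])) (power c (true ∷ [])) ⟩
  compW f (depth e k) (power c (false ∷ [])) ++ compW f (depth e k) (power c (true ∷ []))
    ≡⟨ cong₂ _++_ (compW-power f (depth e k) c (false ∷ [])) (compW-power f (depth e k) c (true ∷ [])) ⟩
  power c (compW f (depth e k) (false ∷ [])) ++ power c (compW f (depth e k) (true ∷ []))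
    ≡⟨ cong (λ v → power c (compW f (depth e k) (false ∷ [])) ++ power c v)
            (compW-complement f (depth e k) (false ∷ [])) ⟩
  power c (compW f (depth e k) (false ∷ [])) ++ power c (complement (compW f (depth e k) (false ∷ [])))
    ≡⟨ cong (λ v → power c v ++ power c (complement v)) (compW-directives s e s≡2^e k) ⟩
  power c (alpha s k) ++ power c (complement (alpha s k))
    ≡⟨ cong (λ t → power t (alpha s k) ++ power t (complement (alpha s k))) (sym (s≡2^e k)) ⟩
  alpha s (suc k) ∎
  where
    f = directives e
    c = 2 ^ e k
    block : ℕ → Morph
    block j = f (depth e k + j)
    block-σ : ∀ j → j < e k → block j ≡ σ
    block-σ j j<ek = trans (directives-depth e k j) (schedule-σ e k (e k) j j<ek)
    block-μ : block (e k) ≡ μ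
    block-μ = trans (directives-depth e k (e k)) (schedule-μ e k (e k))

proposition9p2 : (s : ℕ → ℕ) → (∀ (k : ℕ) → ∃[ n ] s k ≡ 2 ^ n) →
    ∃[ w ] (SAdic w × (∀ (u : Word) → (InLangSeq w u → InLangS s u) × (InLangS s u → InLangSeq w u)))
proposition9p2 s s-pow2 =
  limit f false , limit-SAdic f false , language-of-prefixes (limit f false) (alpha s) alpha-prefix
  where
    e : ℕ → ℕ
    e k = proj₁ (s-pow2 k)
    f : ℕ → Morph
    f = directives e
    alpha-prefix : ∀ k → ∃[ n ] k ≤ n × window (limit f false) 0 n ≡ alpha s k
    alpha-prefix k = 2 ^ depth e k
      , ≤-trans (k≤depth e k) (<⇒≤ (n<2^n (depth e k)))
      , trans (limit-prefix f false (depth e k)) (compW-directives s e (λ j → proj₂ (s-pow2 j)) k)
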